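{- For every set of names $\rho$ and process $P$: if $\rho\vdash P$ then $\rho\subseteq\mathrm{fn}(P)$.
   Context: Processes: $P,Q ::= 0 \mid P \mid Q \mid (\nu a)P \mid (a)P \mid \alpha.P$, with prefixes $\alpha ::= \overline{a}\langle b\rangle$ (output) $\mid a(x)$ (input, binding $x$) $\mid \overline{a}\{b\}$ (send authorization for $b$ on $a$) $\mid a\{b\}$ (receive authorization for $b$ on $a$). $(a)P$ is the authorization scope and does not bind $a$; in $a\{b\}.P$ the name $b$ is not bound. Free names: $\mathrm{fn}(0)=\emptyset$, $\mathrm{fn}(P\mid Q)=\mathrm{fn}(P)\cup\mathrm{fn}(Q)$, $\mathrm{fn}((\nu a)P)=\mathrm{fn}(P)\setminus\{a\}$, $\mathrm{fn}((a)P)=\{a\}\cup\mathrm{fn}(P)$, $\mathrm{fn}(\overline{a}\langle b\rangle.P)=\{a,b\}\cup\mathrm{fn}(P)$, $\mathrm{fn}(a(x).P)=\{a\}\cup(\mathrm{fn}(P)\setminus\{x\})$, $\mathrm{fn}(\overline{a}\{b\}.P)=\mathrm{fn}(a\{b\}.P)=\{a,b\}\cup\mathrm{fn}(P)$. Typing: $\rho$ is a set of names; $\rho\vdash P$ is the least relation closed under: $\emptyset\vdash 0$; from $\rho_1\vdash P$, $\rho_2\vdash Q$ infer $\rho_1\cup\rho_2\vdash P\mid Q$; from $\rho\vdash P$, $a\notin\rho$ infer $\rho\vdash(\nu a)P$; from $\rho\vdash P$ infer $\rho\setminus\{a\}\vdash(a)P$; from $\rho\vdash P$ infer $\rho\cup\{a\}\vdash\overline{a}\langle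 b\rangle.P$; from $\rho\vdash P$, $x\notin\rho$ infer $\rho\cup\{a\}\vdash a(x).P$; from $\rho\vdash P$, $b\notin\rho$ infer $\rho\cup\{a,b\}\vdash\overline{a}\{b\}.P$; from $\rho\vdash P$ infer $(\rho\setminus\{b\})\cup\{a\}\vdash a\{b\}.P$. -}

module Defs where

open import Data.Nat using (ℕ)
open import Data.Product using (_×_; _,_)
open import Data.Sum using (_⊎_)
open import Data.Empty using (⊥)
open import Level using (0ℓ)
open import Relation.Binary.PropositionalEquality using (_≡_; _≢_)
open import Relation.Unary using (Pred; _∪_; _∉_; _⊆_) public

Name : Set
Name = ℕ

NameSet : Set₁
NameSet = Pred Name 0ℓ

∅ₙ : NameSet
∅ₙ _ = ⊥

｛_｝ : Name → NameSet
｛ a ｝ n = n ≡ a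

_∖_ : NameSet → Name → NameSet
(ρ ∖ a) n = ρ n × n ≢ a

data Prefix : Set where
  out   : Name → Name → Prefix
  inp   : Name → Name → Prefix   -- a(x), binds x
  aout  : Name → Name → Prefix
  ainp  : Name → Name → Prefix   -- a{b}, b not bound

data Proc : Set where
  𝟎    : Proc
  _∣_  : Proc → Proc → Proc
  ν    : Name → Proc → Proc
  auth : Name → Proc → Proc
  _∙_  : Prefix → Proc → Proc

fn : Proc → NameSet
fn 𝟎 = ∅ₙ
fn (P ∣ Q) = fn P ∪ fn Q
fn (ν a P) = fn P ∖ a
fn (auth a P) = ｛ a ｝ ∪ fn P
fn (out a b ∙ P) = (｛ a ｝ ∪ ｛ b ｝) ∪ fn P
fn (inp a x ∙ P) = ｛ a ｝ ∪ (fn P ∖ x)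
fn (aout a b ∙ P) = (｛ a ｝ ∪ ｛ b ｝) ∪ fn P
fn (ainp a b ∙ P) = (｛ a ｝ ∪ ｛ b ｝) ∪ fn P

infix 4 _⊢_
data _⊢_ : NameSet → Proc → Set₁ where
  t-nil  : ∅ₙ ⊢ 𝟎
  t-par  : ∀ {ρ₁ ρ₂ P Q} → ρ₁ ⊢ P → ρ₂ ⊢ Q → (ρ₁ ∪ ρ₂) ⊢ (P ∣ Q)
  t-res  : ∀ {ρ a P} → ρ ⊢ P → a ∉ ρ → ρ ⊢ ν a P
  t-auth : ∀ {ρ a P} → ρ ⊢ P → (ρ ∖ a) ⊢ auth a P
  t-out  : ∀ {ρ a b P} → ρ ⊢ P → (ρ ∪ ｛ a ｝) ⊢ (out a b ∙ P)
  t-inp  : ∀ {ρ a x P} → ρ ⊢ P → x ∉ ρ → (ρ ∪ ｛ a ｝) ⊢ (inp a x ∙ P)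
  t-aout : ∀ {ρ a b P} → ρ ⊢ P → b ∉ ρ → (ρ ∪ (｛ a ｝ ∪ ｛ b ｝)) ⊢ (aout a b ∙ P)
  t-ainp : ∀ {ρ a b P} → ρ ⊢ P → ((ρ ∖ b) ∪ ｛ a ｝) ⊢ (ainp a b ∙ P)

module Submission where

-- Each typing rule
-- builds its name set from the set of the premise by a union with the
-- names of a prefix, or by removing a single name; the free names of the
-- process are built from those of the body in the same way.  So every
-- case reduces to elementary facts about ⊆ under union and removal of a
-- name, which are established first:
--   * union is monotone and is the least upper bound for ⊆;
--   * removing a name only shrinks a set;
--   * if a ∉ ρ, then an inclusion ρ ⊆ σ survives removing a from σ.
-- The last fact is where the side conditions a ∉ ρ of the restriction and
-- input rules are used: they guarantee that the name bound by (νa) or a(x)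
-- is not among the typed names, so binding it does not lose any of them.

open import Defs
open import Data.Product using (_,_; proj₁)
open import Data.Sum using (inj₁; inj₂; [_,_]; map)
open import Function using (_∘_)
open import Level using (Level)
open import Relation.Binary.PropositionalEquality using (subst)

private
  variable
    ℓ ℓ₁ ℓ₂ ℓ₃ ℓ₄ : Level
    A : Set ℓ

∪-mono : {ρ₁ : Pred A ℓ₁} {σ₁ : Pred A ℓ₂} {ρ₂ : Pred A ℓ₃} {σ₂ : Pred A ℓ₄} →
         ρ₁ ⊆ σ₁ → ρ₂ ⊆ σ₂ → ρ₁ ∪ ρ₂ ⊆ σ₁ ∪ σ₂
∪-mono ρ₁⊆σ₁ ρ₂⊆σ₂ = map ρ₁⊆σ₁ ρ₂⊆σ₂

∪-least : {ρ : Pred A ℓ₁} {σ : Pred A ℓ₂} {τ : Pred A ℓ₃} →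
          ρ ⊆ τ → σ ⊆ τ → ρ ∪ σ ⊆ τ
∪-least ρ⊆τ σ⊆τ = [ ρ⊆τ , σ⊆τ ]

∖-⊆ : {ρ : NameSet} {a : Name} → ρ ∖ a ⊆ ρ
∖-⊆ = proj₁

⊆-∖-fresh : {ρ σ : NameSet} {a : Name} → ρ ⊆ σ → a ∉ ρ → ρ ⊆ σ ∖ a
⊆-∖-fresh {ρ} ρ⊆σ a∉ρ n∈ρ = ρ⊆σ n∈ρ , λ n≡a → a∉ρ (subst ρ n≡a n∈ρ)

-- The set arguments of the inclusion lemmas
-- are given explicitly where needed: name sets are predicates, and an
-- inclusion between applied predicates does not determine them.
proposition2 : (ρ : NameSet) (P : Proc) → ρ ⊢ P → ρ ⊆ fn P
proposition2 _ _ t-nil = λ ()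
proposition2 _ _ (t-par {P = P} {Q = Q} ⊢P ⊢Q) =
  ∪-mono {σ₁ = fn P} {σ₂ = fn Q} (proposition2 _ _ ⊢P) (proposition2 _ _ ⊢Q)
proposition2 _ _ (t-res {ρ} {P = P} ⊢P a∉ρ) =
  ⊆-∖-fresh (proposition2 ρ P ⊢P) a∉ρ
proposition2 _ _ (t-auth {ρ} {a} {P} ⊢P) =
  inj₂ ∘ proposition2 ρ P ⊢P ∘ ∖-⊆ {ρ} {a}
proposition2 _ _ (t-out {ρ} {a} {b} {P} ⊢P) =
  ∪-least {ρ = ρ} {｛ a ｝} {fn (out a b ∙ P)}
    (inj₂ ∘ proposition2 ρ P ⊢P) (inj₁ ∘ inj₁)
proposition2 _ _ (t-inp {ρ} {a} {x} {P} ⊢P x∉ρ) =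
  ∪-least {ρ = ρ} {｛ a ｝} {fn (inp a x ∙ P)}
    (inj₂ ∘ ⊆-∖-fresh (proposition2 ρ P ⊢P) x∉ρ) inj₁
proposition2 _ _ (t-aout {ρ} {a} {b} {P} ⊢P _) =
  ∪-least {ρ = ρ} {｛ a ｝ ∪ ｛ b ｝} {fn (aout a b ∙ P)}
    (inj₂ ∘ proposition2 ρ P ⊢P) inj₁
proposition2 _ _ (t-ainp {ρ} {a} {b} {P} ⊢P) =
  ∪-least {ρ = ρ ∖ b} {｛ a ｝} {fn (ainp a b ∙ P)}
    (inj₂ ∘ proposition2 ρ P ⊢P ∘ ∖-⊆ {ρ} {b}) (inj₁ ∘ inj₁)
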